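{- Let $f\colon\{0,1,2\}^*\to\{0,1,2\}^*$ be the morphism $0\mapsto012$, $1\mapsto112002$, $2\mapsto\varepsilon$, and let $\mathbf{x}=f^{\omega}(0)=012112002112002\cdots$. Then the abelian complexity of $\mathbf{x}$ is the sequence $1\,3\,5\,(3\,7\,7)^{\omega}$; that is, $\rho^{\mathrm{ab}}_{\mathbf{x}}(0)=1$, $\rho^{\mathrm{ab}}_{\mathbf{x}}(1)=3$, $\rho^{\mathrm{ab}}_{\mathbf{x}}(2)=5$, and for $n\ge3$, $\rho^{\mathrm{ab}}_{\mathbf{x}}(n)=3$ if $n\equiv0\pmod 3$ and $\rho^{\mathrm{ab}}_{\mathbf{x}}(n)=7$ otherwise.
   Context: $f^{\omega}(0)=\lim_n f^n(0)$ is the infinite fixed point of $f$ starting with $0$. The abelian complexity of an infinite word $\mathbf{x}$ is $\rho^{\mathrm{ab}}_{\mathbf{x}}(n)=\#\{\Psi(w)\colon w\text{ a factor of }\mathbf{x},\ |w|=n\}$, where $\Psi(w)=(|w|_0,|w|_1,|w|_2)$ is the Parikh vector of $w$. -}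

module Defs where

open import Data.Nat using (ℕ; zero; suc; _+_)
open import Data.Nat.Properties using (_≟_)
open import Data.Fin using (Fin; zero; suc)
open import Data.List using (List; []; _∷_; concatMap; length)
open import Data.List.Membership.Propositional using (_∈_)
open import Data.List.Relation.Unary.Unique.Propositional using (Unique)
open import Data.Product using (_×_; _,_; ∃)
open import Relation.Binary.PropositionalEquality using (_≡_)

Letter : Set
Letter = Fin 3

fl : Letter → List Letter
fl zero = zero ∷ suc zero ∷ suc (suc zero) ∷ []
fl (suc zero) = suc zero ∷ suc zero ∷ suc (suc zero) ∷ zero ∷ zero ∷ suc (suc zero) ∷ []
fl (suc (suc zero)) = []

f : List Letter → List Letter
f = concatMap fl

iter : ℕ → List Letter → List Letter
iter zero w = w
iter (suc n) w = f (iter n w)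

-- n-th letter of a list (default 0 if out of range; never used below).
nth : List Letter → ℕ → Letter
nth [] _ = zero
nth (a ∷ w) zero = a
nth (a ∷ w) (suc i) = nth w i

-- x = f^ω(0): f^n(0) is a prefix of f^(n+1)(0) and |f^(i+1)(0)| > i,
-- so the i-th letter of x is the i-th letter of f^(i+1)(0).
x : ℕ → Letter
x i = nth (iter (suc i) (zero ∷ [])) i

-- Parikh vector of a word (|w|_0, |w|_1, |w|_2)
Parikh : Set
Parikh = ℕ × ℕ × ℕ

parikhFactor : (ℕ → Letter) → ℕ → ℕ → Parikh
parikhFactor y i zero = 0 , 0 , 0
parikhFactor y i (suc n) with parikhFactor y (suc i) n | y i
... | (a , b , c) | zero = suc a , b , c
... | (a , b , c) | suc zero = a , suc b , c
... | (a , b , c) | suc (suc zero) = a , b , suc c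

-- ρ^ab_y(n) = k : the set {Ψ(w) : w factor of y, |w| = n} has exactly k
-- elements, witnessed by a duplicate-free list enumerating it.
AbelianComplexity : (ℕ → Letter) → ℕ → ℕ → Set
AbelianComplexity y n k =
  ∃ λ (ps : List Parikh) →
    Unique ps × length ps ≡ k ×
    (∀ i → parikhFactor y i n ∈ ps) ×
    (∀ p → p ∈ ps → ∃ λ i → parikhFactor y i n ≡ p)

-- x is the image under the coding τ : 0 ↦ 012, 1 ↦ 112, 2 ↦ 002 of the fixed point β of the
-- 3-uniform morphism μ : 0 ↦ 012, 1 ↦ 121, 2 ↦ 200, because f ∘ τ = τ ∘ μ on words over {0, 12}.
-- In β every 2 directly follows a 1, so Ψ(x[0, 3k)) = k(1,1,1) + [β k = 2](-1,1,0).  Hence a factor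
-- of length s + 3(m+1) starting at digit r of block β k has Parikh vector m(1,1,1) + o, where o depends
-- only on s, r and the blocks at its two ends; o ranges over 3 vectors when s = 0 and over 7 otherwise.
-- All of them are attained, since every pair of letters occurs in β at every distance d ≥ 3 (the pair
-- X, Y at distance q yields X, μ(Y)ₜ at distance 3q + t, and each column of μ is a permutation), and
-- the pairs needed at distances 1 and 2 occur too.
-- The remaining finite case analyses are decided by computation.
module Submission where

open import Data.Fin using (Fin; toℕ; _≟_) renaming (zero to fzero; suc to fsuc)
open import Data.Fin.Properties using (toℕ<n; all?; any?)
open import Data.List using (List; []; _∷_; _++_; length; map)
open import Data.List.Properties using (++-identityʳ; ++-assoc; length-map)
open import Data.List.Membership.Propositional using (_∈_)
open import Data.List.Membership.Propositional.Properties using (∈-map⁻)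
import Data.List.Membership.DecPropositional as DecMembership
open import Data.List.Relation.Unary.All as All using (All)
open import Data.List.Relation.Unary.Any as Any using (Any; here)
import Data.List.Relation.Unary.Any.Properties as Any
open import Data.List.Relation.Unary.Unique.Propositional using (Unique)
import Data.List.Relation.Unary.Unique.Propositional.Properties as Unique
import Data.List.Relation.Unary.Unique.DecPropositional as DecUnique
open import Data.Nat using (ℕ; zero; suc; _+_; _*_; _%_; _≤_; _<_; _<?_; s≤s; z≤n; _≤′_; ≤′-refl; ≤′-step)
open import Data.Nat.DivMod using (DivMod; result; _divMod_; [m+kn]%n≡m%n; m<n⇒m%n≡m)
open import Data.Nat.Induction using (<-rec)
open import Data.Nat.Properties
  using (+-identityʳ; +-assoc; +-comm; +-suc; +-cancelʳ-≡; ≤-trans; ≤-total; ≤⇒≤′; <-≤-trans; ≤-<-trans;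
         +-monoˡ-<; *-monoˡ-≤; m≤m*n; m≤n+m; m<m*n; m<m+n; <⇒≱; ≮⇒≥; anyUpTo?; allUpTo?)
  renaming (_≟_ to _≟ℕ_)
open import Data.Nat.Tactic.RingSolver using (solve-∀)
open import Data.Product using (_×_; ∃; _,_; map₂; proj₂)
open import Data.Product.Properties using (≡-dec)
open import Data.Sum using (inj₁; inj₂)
open import Data.Vec using (Vec; []; _∷_; lookup)
open import Function using (_∘_)
open import Relation.Binary.Definitions using (DecidableEquality)
open import Relation.Binary.PropositionalEquality
  using (_≡_; _≢_; refl; sym; trans; cong; cong₂; subst; subst₂; module ≡-Reasoning)
open import Relation.Nullary.Decidable using (Dec; yes; no; from-yes; ¬?; _×-dec_; _→-dec_)
open import Relation.Nullary.Negation using (¬_; contradiction)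

open import Defs

pattern 𝟎 = fzero
pattern 𝟏 = fsuc fzero
pattern 𝟐 = fsuc (fsuc fzero)

component : Letter → Parikh → ℕ
component 𝟎 (p , _ , _) = p
component 𝟏 (_ , p , _) = p
component 𝟐 (_ , _ , p) = p

component-injective : ∀ {p q} → (∀ a → component a p ≡ component a q) → p ≡ q
component-injective eq = cong₂ _,_ (eq 𝟎) (cong₂ _,_ (eq 𝟏) (eq 𝟐))

_≟ₚ_ : DecidableEquality Parikh
_≟ₚ_ = ≡-dec _≟ℕ_ (≡-dec _≟ℕ_ _≟ℕ_)

open DecUnique _≟ₚ_ using (unique?)
open DecMembership _≟ₚ_ using (_∈?_)

_⊕_ : Parikh → Parikh → Parikh
(a , b , c) ⊕ (a′ , b′ , c′) = a + a′ , b + b′ , c + c′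

unit : Letter → Parikh
unit 𝟎 = 1 , 0 , 0
unit 𝟏 = 0 , 1 , 0
unit 𝟐 = 0 , 0 , 1

diagonal : ℕ → Parikh
diagonal m = m , m , m

component-⊕ : ∀ a p q → component a (p ⊕ q) ≡ component a p + component a q
component-⊕ 𝟎 p q = refl
component-⊕ 𝟏 p q = refl
component-⊕ 𝟐 p q = refl

component-⊕-diagonal : ∀ a o m → component a (o ⊕ diagonal m) ≡ component a o + m
component-⊕-diagonal 𝟎 o m = refl
component-⊕-diagonal 𝟏 o m = refl
component-⊕-diagonal 𝟐 o m = refl

⊕-diagonal-injective : ∀ m {o o′} → o ⊕ diagonal m ≡ o′ ⊕ diagonal m → o ≡ o′
⊕-diagonal-injective m {o} {o′} eq = component-injective λ a → +-cancelʳ-≡ m _ _ (begin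
  component a o + m             ≡⟨ sym (component-⊕-diagonal a o m) ⟩
  component a (o ⊕ diagonal m)  ≡⟨ cong (component a) eq ⟩
  component a (o′ ⊕ diagonal m) ≡⟨ component-⊕-diagonal a o′ m ⟩
  component a o′ + m            ∎)
  where open ≡-Reasoning

parikhFactor-suc : ∀ y i n → parikhFactor y i (suc n) ≡ unit (y i) ⊕ parikhFactor y (suc i) n
parikhFactor-suc y i n with parikhFactor y (suc i) n | y i
... | _ | 𝟎 = refl
... | _ | 𝟏 = refl
... | _ | 𝟐 = refl

occurrences : Letter → (ℕ → Letter) → ℕ → ℕ → ℕ
occurrences a y i zero = 0
occurrences a y i (suc n) = component a (unit (y i)) + occurrences a y (suc i) n

component-parikhFactor : ∀ a y i n → component a (parikhFactor y i n) ≡ occurrences a y i n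
component-parikhFactor 𝟎 y i zero = refl
component-parikhFactor 𝟏 y i zero = refl
component-parikhFactor 𝟐 y i zero = refl
component-parikhFactor a y i (suc n) = begin
  component a (parikhFactor y i (suc n))                            ≡⟨ cong (component a) (parikhFactor-suc y i n) ⟩
  component a (unit (y i) ⊕ parikhFactor y (suc i) n)              ≡⟨ component-⊕ a (unit (y i)) _ ⟩
  component a (unit (y i)) + component a (parikhFactor y (suc i) n) ≡⟨ cong (_ +_) (component-parikhFactor a y (suc i) n) ⟩
  occurrences a y i (suc n)                                         ∎
  where open ≡-Reasoning

occurrences-+ : ∀ a y i m n → occurrences a y i (m + n) ≡ occurrences a y i m + occurrences a y (i + m) n
occurrences-+ a y i zero n = cong (λ j → occurrences a y j n) (sym (+-identityʳ i))
occurrences-+ a y i (suc m) n = begin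
  ya + occurrences a y (suc i) (m + n)                             ≡⟨ cong (ya +_) (occurrences-+ a y (suc i) m n) ⟩
  ya + (occurrences a y (suc i) m + occurrences a y (suc i + m) n) ≡⟨ sym (+-assoc ya _ _) ⟩
  occurrences a y i (suc m) + occurrences a y (suc (i + m)) n
    ≡⟨ cong (λ j → occurrences a y i (suc m) + occurrences a y j n) (sym (+-suc i m)) ⟩
  occurrences a y i (suc m) + occurrences a y (i + suc m) n        ∎
  where
  open ≡-Reasoning
  ya = component a (unit (y i))

occurrences-snoc : ∀ a y i → occurrences a y 0 (suc i) ≡ occurrences a y 0 i + component a (unit (y i))
occurrences-snoc a y i = begin
  occurrences a y 0 (suc i)                                   ≡⟨ cong (occurrences a y 0) (+-comm 1 i) ⟩
  occurrences a y 0 (i + 1)                                   ≡⟨ occurrences-+ a y 0 i 1 ⟩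
  occurrences a y 0 i + (component a (unit (y i)) + 0)        ≡⟨ cong (occurrences a y 0 i +_) (+-identityʳ _) ⟩
  occurrences a y 0 i + component a (unit (y i))              ∎
  where open ≡-Reasoning

-- x is the image under τ of the fixed point β of μ

μ τ : Letter → Vec Letter 3
μ 𝟎 = 𝟎 ∷ 𝟏 ∷ 𝟐 ∷ []
μ 𝟏 = 𝟏 ∷ 𝟐 ∷ 𝟏 ∷ []
μ 𝟐 = 𝟐 ∷ 𝟎 ∷ 𝟎 ∷ []
τ 𝟎 = 𝟎 ∷ 𝟏 ∷ 𝟐 ∷ []
τ 𝟏 = 𝟏 ∷ 𝟏 ∷ 𝟐 ∷ []
τ 𝟐 = 𝟎 ∷ 𝟎 ∷ 𝟐 ∷ []

hom : (Letter → Vec Letter 3) → List Letter → List Letter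
hom h [] = []
hom h (a ∷ u) = lookup (h a) 𝟎 ∷ lookup (h a) 𝟏 ∷ lookup (h a) 𝟐 ∷ hom h u

hom-++ : ∀ h u v → hom h (u ++ v) ≡ hom h u ++ hom h v
hom-++ h [] v = refl
hom-++ h (a ∷ u) v = cong (λ w → lookup (h a) 𝟎 ∷ lookup (h a) 𝟏 ∷ lookup (h a) 𝟐 ∷ w) (hom-++ h u v)

length-hom : ∀ h u → length (hom h u) ≡ length u * 3
length-hom h [] = refl
length-hom h (a ∷ u) = cong (λ n → suc (suc (suc n))) (length-hom h u)

nth-++ˡ : ∀ u v {k} → k < length u → nth (u ++ v) k ≡ nth u k
nth-++ˡ (a ∷ u) v {zero} _ = refl
nth-++ˡ (a ∷ u) v {suc k} (s≤s k<) = nth-++ˡ u v k<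

nth-hom : ∀ h u k r → k < length u → nth (hom h u) (toℕ r + k * 3) ≡ lookup (h (nth u k)) r
nth-hom h (a ∷ u) zero 𝟎 _ = refl
nth-hom h (a ∷ u) zero 𝟏 _ = refl
nth-hom h (a ∷ u) zero 𝟐 _ = refl
nth-hom h (a ∷ u) (suc k) 𝟎 (s≤s k<) = nth-hom h u k 𝟎 k<
nth-hom h (a ∷ u) (suc k) 𝟏 (s≤s k<) = nth-hom h u k 𝟏 k<
nth-hom h (a ∷ u) (suc k) 𝟐 (s≤s k<) = nth-hom h u k 𝟐 k<

digit-< : ∀ (r : Fin 3) {k L} → k < L → toℕ r + k * 3 < L * 3
digit-< r {k} k<L = <-≤-trans (+-monoˡ-< (k * 3) (toℕ<n r)) (*-monoˡ-≤ 3 k<L)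

3≰digit : ∀ (r : Fin 3) → ¬ (3 ≤ toℕ r + 0 * 3)
3≰digit r 3≤r = <⇒≱ (toℕ<n r) (subst (3 ≤_) (+-identityʳ (toℕ r)) 3≤r)

βPrefix : ℕ → List Letter
βPrefix zero = 𝟎 ∷ []
βPrefix (suc j) = hom μ (βPrefix j)

β : ℕ → Letter
β k = nth (βPrefix k) k

βPrefix-suc : ∀ j → ∃ λ t → βPrefix (suc j) ≡ βPrefix j ++ t
βPrefix-suc zero = 𝟏 ∷ 𝟐 ∷ [] , refl
βPrefix-suc (suc j) with βPrefix-suc j
... | t , eq = hom μ t , trans (cong (hom μ) eq) (hom-++ μ (βPrefix j) t)

βPrefix-extends : ∀ {j j′} → j ≤′ j′ → ∃ λ t → βPrefix j′ ≡ βPrefix j ++ t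
βPrefix-extends {j} ≤′-refl = [] , sym (++-identityʳ (βPrefix j))
βPrefix-extends {j} (≤′-step {j′} j≤j′) with βPrefix-extends j≤j′ | βPrefix-suc j′
... | t , eq | t′ , eq′ = t ++ t′ , (begin
  βPrefix (suc j′)         ≡⟨ eq′ ⟩
  βPrefix j′ ++ t′         ≡⟨ cong (_++ t′) eq ⟩
  (βPrefix j ++ t) ++ t′   ≡⟨ ++-assoc (βPrefix j) t t′ ⟩
  βPrefix j ++ (t ++ t′)   ∎)
  where open ≡-Reasoning

βPrefix-long : ∀ j → j < length (βPrefix j)
βPrefix-long zero = s≤s z≤n
βPrefix-long (suc j) = subst (suc j <_) (sym (length-hom μ (βPrefix j)))
  (≤-trans (s≤s (s≤s (m≤m*n j 3))) (digit-< 𝟏 (βPrefix-long j)))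

nth-βPrefix-mono : ∀ {j j′ k} → j ≤ j′ → k < length (βPrefix j) → nth (βPrefix j′) k ≡ nth (βPrefix j) k
nth-βPrefix-mono {j} {k = k} j≤j′ k< with βPrefix-extends (≤⇒≤′ j≤j′)
... | t , eq = trans (cong (λ w → nth w k) eq) (nth-++ˡ (βPrefix j) t k<)

nth-βPrefix : ∀ j {k} → k < length (βPrefix j) → nth (βPrefix j) k ≡ β k
nth-βPrefix j {k} k< with ≤-total j k
... | inj₁ j≤k = sym (nth-βPrefix-mono j≤k k<)
... | inj₂ k≤j = nth-βPrefix-mono k≤j (βPrefix-long k)

β-digit : ∀ r k → β (toℕ r + k * 3) ≡ lookup (μ (β k)) r
β-digit r k = begin
  β (toℕ r + k * 3)                       ≡⟨ sym (nth-βPrefix (suc k) i<) ⟩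
  nth (hom μ (βPrefix k)) (toℕ r + k * 3) ≡⟨ nth-hom μ (βPrefix k) k r (βPrefix-long k) ⟩
  lookup (μ (β k)) r                      ∎
  where
  open ≡-Reasoning
  i< : toℕ r + k * 3 < length (βPrefix (suc k))
  i< = subst (toℕ r + k * 3 <_) (sym (length-hom μ (βPrefix k))) (digit-< r (βPrefix-long k))

data Word-0-12 : List Letter → Set where
  []   : Word-0-12 []
  𝟎∷_  : ∀ {u} → Word-0-12 u → Word-0-12 (𝟎 ∷ u)
  𝟏𝟐∷_ : ∀ {u} → Word-0-12 u → Word-0-12 (𝟏 ∷ 𝟐 ∷ u)

hom-μ-Word-0-12 : ∀ {u} → Word-0-12 u → Word-0-12 (hom μ u)
hom-μ-Word-0-12 [] = []
hom-μ-Word-0-12 (𝟎∷ w) = 𝟎∷ 𝟏𝟐∷ hom-μ-Word-0-12 w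
hom-μ-Word-0-12 (𝟏𝟐∷ w) = 𝟏𝟐∷ 𝟏𝟐∷ 𝟎∷ 𝟎∷ hom-μ-Word-0-12 w

βPrefix-Word-0-12 : ∀ j → Word-0-12 (βPrefix j)
βPrefix-Word-0-12 zero = 𝟎∷ []
βPrefix-Word-0-12 (suc j) = hom-μ-Word-0-12 (βPrefix-Word-0-12 j)

-- f ∘ τ and τ ∘ μ differ on the word 1 (f (τ 1) = τ (1212)), but agree on the words 0 and 12.
f-hom-τ : ∀ {u} → Word-0-12 u → f (hom τ u) ≡ hom τ (hom μ u)
f-hom-τ [] = refl
f-hom-τ (𝟎∷ w) = cong (hom τ (𝟎 ∷ 𝟏 ∷ 𝟐 ∷ []) ++_) (f-hom-τ w)
f-hom-τ (𝟏𝟐∷ w) = cong (hom τ (𝟏 ∷ 𝟐 ∷ 𝟏 ∷ 𝟐 ∷ 𝟎 ∷ 𝟎 ∷ []) ++_) (f-hom-τ w)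

iter-βPrefix : ∀ j → iter (suc j) (𝟎 ∷ []) ≡ hom τ (βPrefix j)
iter-βPrefix zero = refl
iter-βPrefix (suc j) = trans (cong f (iter-βPrefix j)) (f-hom-τ (βPrefix-Word-0-12 j))

x-digit : ∀ r k → x (toℕ r + k * 3) ≡ lookup (τ (β k)) r
x-digit r k = begin
  nth (iter (suc i) (𝟎 ∷ [])) i       ≡⟨ cong (λ w → nth w i) (iter-βPrefix i) ⟩
  nth (hom τ (βPrefix i)) i           ≡⟨ nth-hom τ (βPrefix i) k r k< ⟩
  lookup (τ (nth (βPrefix i) k)) r    ≡⟨ cong (λ X → lookup (τ X) r) (nth-βPrefix i k<) ⟩
  lookup (τ (β k)) r                  ∎
  where
  open ≡-Reasoning
  i = toℕ r + k * 3
  k< : k < length (βPrefix i)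
  k< = ≤-<-trans (≤-trans (m≤m*n k 3) (m≤n+m (k * 3) (toℕ r))) (βPrefix-long i)

data Adjacent : Letter → Letter → Set where
  𝟎𝟎 : Adjacent 𝟎 𝟎
  𝟎𝟏 : Adjacent 𝟎 𝟏
  𝟏𝟐 : Adjacent 𝟏 𝟐
  𝟐𝟏 : Adjacent 𝟐 𝟏
  𝟐𝟎 : Adjacent 𝟐 𝟎

adjacent-μ-𝟎𝟏 : ∀ X → Adjacent (lookup (μ X) 𝟎) (lookup (μ X) 𝟏)
adjacent-μ-𝟎𝟏 𝟎 = 𝟎𝟏
adjacent-μ-𝟎𝟏 𝟏 = 𝟏𝟐
adjacent-μ-𝟎𝟏 𝟐 = 𝟐𝟎

adjacent-μ-𝟏𝟐 : ∀ X → Adjacent (lookup (μ X) 𝟏) (lookup (μ X) 𝟐)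
adjacent-μ-𝟏𝟐 𝟎 = 𝟏𝟐
adjacent-μ-𝟏𝟐 𝟏 = 𝟐𝟏
adjacent-μ-𝟏𝟐 𝟐 = 𝟎𝟎

adjacent-μ-𝟐𝟎 : ∀ {X Y} → Adjacent X Y → Adjacent (lookup (μ X) 𝟐) (lookup (μ Y) 𝟎)
adjacent-μ-𝟐𝟎 𝟎𝟎 = 𝟐𝟎
adjacent-μ-𝟐𝟎 𝟎𝟏 = 𝟐𝟏
adjacent-μ-𝟐𝟎 𝟏𝟐 = 𝟏𝟐
adjacent-μ-𝟐𝟎 𝟐𝟏 = 𝟎𝟏
adjacent-μ-𝟐𝟎 𝟐𝟎 = 𝟎𝟎

adjacent-β : ∀ k → Adjacent (β k) (β (suc k))
adjacent-β = <-rec _ step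
  where
  step : ∀ k → (∀ {q} → q < k → Adjacent (β q) (β (suc q))) → Adjacent (β k) (β (suc k))
  step k rec with k divMod 3
  ... | result q 𝟎 refl = subst₂ Adjacent (sym (β-digit 𝟎 q)) (sym (β-digit 𝟏 q)) (adjacent-μ-𝟎𝟏 (β q))
  ... | result q 𝟏 refl = subst₂ Adjacent (sym (β-digit 𝟏 q)) (sym (β-digit 𝟐 q)) (adjacent-μ-𝟏𝟐 (β q))
  ... | result q 𝟐 refl = subst₂ Adjacent (sym (β-digit 𝟐 q)) (sym (β-digit 𝟎 (suc q)))
                            (adjacent-μ-𝟐𝟎 (rec (s≤s (≤-trans (m≤m*n q 3) (m≤n+m (q * 3) 1)))))

prefix : Letter → ℕ → ℕ
prefix a = occurrences a x 0

headCount : Letter → Fin 3 → Letter → ℕ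
headCount a 𝟎 X = 0
headCount a 𝟏 X = component a (unit (lookup (τ X) 𝟎))
headCount a 𝟐 X = headCount a 𝟏 X + component a (unit (lookup (τ X) 𝟏))

blockCount : Letter → Letter → ℕ
blockCount a X = headCount a 𝟐 X + component a (unit (lookup (τ X) 𝟐))

prefix-digit : ∀ a r k → prefix a (toℕ r + k * 3) ≡ prefix a (k * 3) + headCount a r (β k)
prefix-digit a 𝟎 k = sym (+-identityʳ _)
prefix-digit a 𝟏 k =
  trans (occurrences-snoc a x (k * 3)) (cong (λ X → prefix a (k * 3) + component a (unit X)) (x-digit 𝟎 k))
prefix-digit a 𝟐 k = begin
  prefix a (2 + k * 3)                                      ≡⟨ occurrences-snoc a x (1 + k * 3) ⟩
  prefix a (1 + k * 3) + component a (unit (x (1 + k * 3)))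
    ≡⟨ cong₂ _+_ (prefix-digit a 𝟏 k) (cong (component a ∘ unit) (x-digit 𝟏 k)) ⟩
  prefix a (k * 3) + headCount a 𝟏 (β k) + _               ≡⟨ +-assoc (prefix a (k * 3)) _ _ ⟩
  prefix a (k * 3) + headCount a 𝟐 (β k)                   ∎
  where open ≡-Reasoning

prefix-next-block : ∀ a k → prefix a (suc k * 3) ≡ prefix a (k * 3) + blockCount a (β k)
prefix-next-block a k = begin
  prefix a (suc (2 + k * 3))                                ≡⟨ occurrences-snoc a x (2 + k * 3) ⟩
  prefix a (2 + k * 3) + component a (unit (x (2 + k * 3)))
    ≡⟨ cong₂ _+_ (prefix-digit a 𝟐 k) (cong (component a ∘ unit) (x-digit 𝟐 k)) ⟩
  prefix a (k * 3) + headCount a 𝟐 (β k) + _               ≡⟨ +-assoc (prefix a (k * 3)) _ _ ⟩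
  prefix a (k * 3) + blockCount a (β k)                    ∎
  where open ≡-Reasoning

-- deficit a X and surplus a X are the negative and positive parts of the a-component of [X = 2](-1,1,0).
deficit surplus : Letter → Letter → ℕ
deficit 𝟎 𝟐 = 1
deficit _ _ = 0
surplus 𝟏 𝟐 = 1
surplus _ _ = 0

adjacent-balance : ∀ {X Y} → Adjacent X Y → ∀ a →
  blockCount a X + surplus a X + deficit a Y ≡ suc (surplus a Y + deficit a X)
adjacent-balance 𝟎𝟎 = λ { 𝟎 → refl ; 𝟏 → refl ; 𝟐 → refl }
adjacent-balance 𝟎𝟏 = λ { 𝟎 → refl ; 𝟏 → refl ; 𝟐 → refl }
adjacent-balance 𝟏𝟐 = λ { 𝟎 → refl ; 𝟏 → refl ; 𝟐 → refl }
adjacent-balance 𝟐𝟏 = λ { 𝟎 → refl ; 𝟏 → refl ; 𝟐 → refl }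
adjacent-balance 𝟐𝟎 = λ { 𝟎 → refl ; 𝟏 → refl ; 𝟐 → refl }

prefix-block : ∀ a k → prefix a (k * 3) + deficit a (β k) ≡ k + surplus a (β k)
prefix-block 𝟎 zero = refl
prefix-block 𝟏 zero = refl
prefix-block 𝟐 zero = refl
prefix-block a (suc k) = +-cancelʳ-≡ dX _ _ (begin
  prefix a (suc k * 3) + dY + dX ≡⟨ cong (λ n → n + dY + dX) (prefix-next-block a k) ⟩
  P + B + dY + dX                ≡⟨ shuffle₁ P B dY dX ⟩
  P + dX + B + dY                ≡⟨ cong (λ n → n + B + dY) (prefix-block a k) ⟩
  k + sX + B + dY                ≡⟨ shuffle₂ k sX B dY ⟩
  k + (B + sX + dY)              ≡⟨ cong (k +_) (adjacent-balance (adjacent-β k) a) ⟩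
  k + suc (sY + dX)              ≡⟨ shuffle₃ k sY dX ⟩
  suc k + sY + dX                ∎)
  where
  open ≡-Reasoning
  P = prefix a (k * 3)
  B = blockCount a (β k)
  dX = deficit a (β k)
  dY = deficit a (β (suc k))
  sX = surplus a (β k)
  sY = surplus a (β (suc k))
  shuffle₁ : ∀ p b d e → p + b + d + e ≡ p + e + b + d
  shuffle₁ = solve-∀
  shuffle₂ : ∀ k s b d → k + s + b + d ≡ k + (b + s + d)
  shuffle₂ = solve-∀
  shuffle₃ : ∀ k s d → k + suc (s + d) ≡ suc k + s + d
  shuffle₃ = solve-∀

level : Letter → Fin 3 → Letter → ℕ
level a r X = headCount a r X + surplus a X

prefix-level : ∀ a r k → prefix a (toℕ r + k * 3) + deficit a (β k) ≡ k + level a r (β k)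
prefix-level a r k = begin
  prefix a (toℕ r + k * 3) + d   ≡⟨ cong (_+ d) (prefix-digit a r k) ⟩
  prefix a (k * 3) + h + d       ≡⟨ shuffle₁ (prefix a (k * 3)) h d ⟩
  prefix a (k * 3) + d + h       ≡⟨ cong (_+ h) (prefix-block a k) ⟩
  k + surplus a (β k) + h        ≡⟨ shuffle₂ k (surplus a (β k)) h ⟩
  k + level a r (β k)            ∎
  where
  open ≡-Reasoning
  d = deficit a (β k)
  h = headCount a r (β k)
  shuffle₁ : ∀ p h d → p + h + d ≡ p + d + h
  shuffle₁ = solve-∀
  shuffle₂ : ∀ k s h → k + s + h ≡ k + (h + s)
  shuffle₂ = solve-∀

window-balance : ∀ a r k r′ e n → toℕ r + k * 3 + n ≡ toℕ r′ + (k + e) * 3 →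
  occurrences a x (toℕ r + k * 3) n + (level a r (β k) + deficit a (β (k + e)))
    ≡ level a r′ (β (k + e)) + deficit a (β k) + e
window-balance a r k r′ e n end = +-cancelʳ-≡ (P + dX) _ _ (begin
  F + (lX + dY) + (P + dX)                          ≡⟨ shuffle₁ F lX dY P dX ⟩
  P + F + dY + (lX + dX)                            ≡⟨ cong (λ q → q + dY + (lX + dX)) (sym (occurrences-+ a x 0 i n)) ⟩
  prefix a (i + n) + dY + (lX + dX)                 ≡⟨ cong (λ j → prefix a j + dY + (lX + dX)) end ⟩
  prefix a (toℕ r′ + (k + e) * 3) + dY + (lX + dX)  ≡⟨ cong (_+ (lX + dX)) (prefix-level a r′ (k + e)) ⟩
  k + e + lY + (lX + dX)                            ≡⟨ shuffle₂ k e lY lX dX ⟩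
  lY + dX + e + (k + lX)                            ≡⟨ cong (lY + dX + e +_) (sym (prefix-level a r k)) ⟩
  lY + dX + e + (P + dX)                            ∎)
  where
  open ≡-Reasoning
  i = toℕ r + k * 3
  P = prefix a i
  F = occurrences a x i n
  dX = deficit a (β k)
  dY = deficit a (β (k + e))
  lX = level a r (β k)
  lY = level a r′ (β (k + e))
  shuffle₁ : ∀ f l d p d′ → f + (l + d) + (p + d′) ≡ p + f + d + (l + d′)
  shuffle₁ = solve-∀
  shuffle₂ : ∀ k e l l′ d → k + e + l + (l′ + d) ≡ l + d + e + (k + l′)
  shuffle₂ = solve-∀

-- Parikh vectors of long factors

digitSum : (r s : Fin 3) → DivMod (toℕ r + toℕ s) 3
digitSum r s = (toℕ r + toℕ s) divMod 3

carry : Fin 3 → Fin 3 → ℕ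
carry r s = DivMod.quotient (digitSum r s)

-- o + m(1,1,1) is the Parikh vector of a factor of length s + 3(m+1) that starts at digit r of a block
-- equal to X and stops just before digit r′ of a block equal to Y, where r + s = r′ + 3 carry r s
-- (parikhFactor-window).
WindowVector : Fin 3 → Fin 3 → Letter → Letter → Parikh → Set
WindowVector s r X Y o =
  ∀ a → component a o + (level a r X + deficit a Y) ≡ level a r′ Y + deficit a X + suc (carry r s)
  where r′ = DivMod.remainder (digitSum r s)

windowVector? : ∀ s r X Y o → Dec (WindowVector s r X Y o)
windowVector? s r X Y o = all? λ a → _ ≟ℕ _

offset-cancel : ∀ {F L R o} c m → F + L ≡ R + (c + suc m) → o + L ≡ R + suc c → F ≡ o + m
offset-cancel {F} {L} {R} {o} c m window vector = +-cancelʳ-≡ L F (o + m) (begin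
  F + L              ≡⟨ window ⟩
  R + (c + suc m)    ≡⟨ shuffle₁ R c m ⟩
  R + suc c + m      ≡⟨ cong (_+ m) (sym vector) ⟩
  o + L + m          ≡⟨ shuffle₂ o L m ⟩
  o + m + L          ∎)
  where
  open ≡-Reasoning
  shuffle₁ : ∀ R c m → R + (c + suc m) ≡ R + suc c + m
  shuffle₁ = solve-∀
  shuffle₂ : ∀ o L m → o + L + m ≡ o + m + L
  shuffle₂ = solve-∀

window-end : ∀ r s k m → toℕ r + k * 3 + (toℕ s + suc m * 3)
                         ≡ toℕ (DivMod.remainder (digitSum r s)) + (k + (carry r s + suc m)) * 3
window-end r s k m = begin
  toℕ r + k * 3 + (toℕ s + suc m * 3)  ≡⟨ shuffle₁ (toℕ r) k (toℕ s) m ⟩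
  toℕ r + toℕ s + (k + suc m) * 3      ≡⟨ cong (_+ (k + suc m) * 3) digits ⟩
  toℕ r′ + c * 3 + (k + suc m) * 3     ≡⟨ shuffle₂ (toℕ r′) c k m ⟩
  toℕ r′ + (k + (c + suc m)) * 3       ∎
  where
  open ≡-Reasoning
  open DivMod (digitSum r s) renaming (quotient to c; remainder to r′; property to digits)
  shuffle₁ : ∀ r k s m → r + k * 3 + (s + suc m * 3) ≡ r + s + (k + suc m) * 3
  shuffle₁ = solve-∀
  shuffle₂ : ∀ r c k m → r + c * 3 + (k + suc m) * 3 ≡ r + (k + (c + suc m)) * 3
  shuffle₂ = solve-∀

parikhFactor-window : ∀ s r k m {o} → WindowVector s r (β k) (β (k + (carry r s + suc m))) o →
  parikhFactor x (toℕ r + k * 3) (toℕ s + suc m * 3) ≡ o ⊕ diagonal m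
parikhFactor-window s r k m {o} vector = component-injective λ a → begin
  component a (parikhFactor x i n) ≡⟨ component-parikhFactor a x i n ⟩
  occurrences a x i n
    ≡⟨ offset-cancel (carry r s) m (window-balance a r k _ _ n (window-end r s k m)) (vector a) ⟩
  component a o + m                ≡⟨ sym (component-⊕-diagonal a o m) ⟩
  component a (o ⊕ diagonal m)     ∎
  where
  open ≡-Reasoning
  i = toℕ r + k * 3
  n = toℕ s + suc m * 3

offsets : Fin 3 → List Parikh
offsets 𝟎 = (0 , 2 , 1) ∷ (1 , 1 , 1) ∷ (2 , 0 , 1) ∷ []
offsets 𝟏 = (0 , 2 , 2) ∷ (0 , 3 , 1) ∷ (1 , 1 , 2) ∷ (1 , 2 , 1) ∷ (2 , 0 , 2) ∷ (2 , 1 , 1) ∷ (3 , 0 , 1) ∷ []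
offsets 𝟐 = (0 , 3 , 2) ∷ (1 , 2 , 2) ∷ (1 , 3 , 1) ∷ (2 , 1 , 2) ∷ (2 , 2 , 1) ∷ (3 , 0 , 2) ∷ (3 , 1 , 1) ∷ []

offsets-unique : ∀ s → Unique (offsets s)
offsets-unique = from-yes (all? λ s → unique? (offsets s))

offsets-complete : ∀ s r X Y → Any (WindowVector s r X Y) (offsets s)
offsets-complete = from-yes (all? λ s → all? λ r → all? λ X → all? λ Y →
  Any.any? (windowVector? s r X Y) (offsets s))

parikhFactor-∈-offsets : ∀ s m i → parikhFactor x i (toℕ s + suc m * 3) ∈ map (_⊕ diagonal m) (offsets s)
parikhFactor-∈-offsets s m i with i divMod 3
... | result k r refl =
  Any.map⁺ (Any.map (parikhFactor-window s r k m) (offsets-complete s r (β k) (β (k + (carry r s + suc m)))))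

-- Pairs of letters of β at a given distance

OccursAt : ℕ → Letter → Letter → Set
OccursAt d X Y = ∃ λ k → β k ≡ X × β (k + d) ≡ Y

OccursBefore : ℕ → ℕ → Letter → Letter → Set
OccursBefore N d X Y = ∃ λ k → k < N × (β k ≡ X × β (k + d) ≡ Y)

occursBefore? : ∀ N d X Y → Dec (OccursBefore N d X Y)
occursBefore? N d X Y = anyUpTo? (λ k → (β k ≟ X) ×-dec (β (k + d) ≟ Y)) N

μ-head : ∀ X → lookup (μ X) 𝟎 ≡ X
μ-head 𝟎 = refl
μ-head 𝟏 = refl
μ-head 𝟐 = refl

μ-column-onto : ∀ t Y → ∃ λ Y′ → lookup (μ Y′) t ≡ Y
μ-column-onto = from-yes (all? λ t → all? λ Y → any? λ Y′ → lookup (μ Y′) t ≟ Y)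

occursAt-μ : ∀ t {q X Y} → OccursAt q X Y → OccursAt (toℕ t + q * 3) X (lookup (μ Y) t)
occursAt-μ t {q} (k , refl , refl) = k * 3 , trans (β-digit 𝟎 k) (μ-head (β k)) , (begin
  β (k * 3 + (toℕ t + q * 3))   ≡⟨ cong β (shuffle k (toℕ t) q) ⟩
  β (toℕ t + (k + q) * 3)       ≡⟨ β-digit t (k + q) ⟩
  lookup (μ (β (k + q))) t      ∎)
  where
  open ≡-Reasoning
  shuffle : ∀ k t q → k * 3 + (t + q * 3) ≡ t + (k + q) * 3
  shuffle = solve-∀

-- The least occurrence needed is that of the pair 2, 1 at distance 8, at position 65.
occursBefore-3-to-8 : ∀ (t : Fin 3) (q : Fin 2) X Y → OccursBefore 66 (toℕ t + suc (toℕ q) * 3) X Y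
occursBefore-3-to-8 = from-yes (all? λ (t : Fin 3) → all? λ (q : Fin 2) → all? λ X → all? λ Y →
  occursBefore? 66 (toℕ t + suc (toℕ q) * 3) X Y)

occursAt-far : ∀ d → 3 ≤ d → ∀ X Y → OccursAt d X Y
occursAt-far = <-rec _ step
  where
  step : ∀ d → (∀ {d′} → d′ < d → 3 ≤ d′ → ∀ X Y → OccursAt d′ X Y) →
         3 ≤ d → ∀ X Y → OccursAt d X Y
  step d rec 3≤d X Y with d divMod 3
  ... | result 0 t refl = contradiction 3≤d (3≰digit t)
  ... | result 1 t refl = map₂ proj₂ (occursBefore-3-to-8 t 𝟎 X Y)
  ... | result 2 t refl = map₂ proj₂ (occursBefore-3-to-8 t 𝟏 X Y)
  ... | result q@(suc (suc (suc _))) t refl with μ-column-onto t Y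
  ...   | Y′ , refl = occursAt-μ t (rec q<d (s≤s (s≤s (s≤s z≤n))) X Y′)
    where
    q<d : q < toℕ t + q * 3
    q<d = <-≤-trans (m<m*n q 3 (s≤s (s≤s z≤n))) (m≤n+m (q * 3) (toℕ t))

occursAt-beyond : ∀ {c X Y} → (∀ {d} → d < 3 → c < d → OccursBefore 24 d X Y) →
                  ∀ m → OccursAt (c + suc m) X Y
occursAt-beyond {c} near m with c + suc m <? 3
... | yes e<3 = map₂ proj₂ (near e<3 (m<m+n c (s≤s z≤n)))
... | no e≮3 = occursAt-far _ (≮⇒≥ e≮3) _ _

Realisable : Fin 3 → Parikh → Set
Realisable s o = ∃ λ r → ∃ λ X → ∃ λ Y →
  WindowVector s r X Y o × (∀ {d} → d < 3 → carry r s < d → OccursBefore 24 d X Y)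

offsets-realisable : ∀ s → All (Realisable s) (offsets s)
offsets-realisable = from-yes (all? λ s → All.all? (λ o →
  any? λ r → any? λ X → any? λ Y →
    windowVector? s r X Y o ×-dec allUpTo? (λ d → carry r s <? d →-dec occursBefore? 24 d X Y) 3) (offsets s))

realisable-window : ∀ s m {o} → Realisable s o → ∃ λ i → parikhFactor x i (toℕ s + suc m * 3) ≡ o ⊕ diagonal m
realisable-window s m (r , X , Y , vector , near) with occursAt-beyond near m
... | k , refl , refl = toℕ r + k * 3 , parikhFactor-window s r k m vector

abelianComplexity-offsets : ∀ s m → AbelianComplexity x (toℕ s + suc m * 3) (length (offsets s))
abelianComplexity-offsets s m =
  map (_⊕ diagonal m) (offsets s) ,
  Unique.map⁺ (⊕-diagonal-injective m) (offsets-unique s) ,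
  length-map (_⊕ diagonal m) (offsets s) ,
  parikhFactor-∈-offsets s m ,
  realised
  where
  realised : ∀ p → p ∈ map (_⊕ diagonal m) (offsets s) → ∃ λ i → parikhFactor x i (toℕ s + suc m * 3) ≡ p
  realised p p∈ with ∈-map⁻ (_⊕ diagonal m) p∈
  ... | o , o∈ , refl = realisable-window s m (All.lookup (offsets-realisable s) o∈)

digit-mod : ∀ s q → (toℕ s + q * 3) % 3 ≡ toℕ s
digit-mod s q = trans ([m+kn]%n≡m%n (toℕ s) q 3) (m<n⇒m%n≡m (toℕ<n s))

abelianComplexity-≥3 : ∀ n → 3 ≤ n →
  (n % 3 ≡ 0 → AbelianComplexity x n 3) × (n % 3 ≢ 0 → AbelianComplexity x n 7)
abelianComplexity-≥3 n 3≤n with n divMod 3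
... | result 0 s refl = contradiction 3≤n (3≰digit s)
... | result (suc m) 𝟎 refl = (λ _ → abelianComplexity-offsets 𝟎 m) , contradiction (digit-mod 𝟎 (suc m))
... | result (suc m) 𝟏 refl =
  (λ ≡0 → contradiction (trans (sym (digit-mod 𝟏 (suc m))) ≡0) λ ()) , (λ _ → abelianComplexity-offsets 𝟏 m)
... | result (suc m) 𝟐 refl =
  (λ ≡0 → contradiction (trans (sym (digit-mod 𝟐 (suc m))) ≡0) λ ()) , (λ _ → abelianComplexity-offsets 𝟐 m)

-- Short factors

abelianComplexity-0 : AbelianComplexity x 0 1
abelianComplexity-0 =
  (0 , 0 , 0) ∷ [] , from-yes (unique? ((0 , 0 , 0) ∷ [])) , refl , (λ _ → here refl) , λ { _ (here refl) → 0 , refl }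

abelianComplexity-1 : AbelianComplexity x 1 3
abelianComplexity-1 =
  letters , from-yes (unique? letters) , refl , complete , λ _ p∈ → map₂ proj₂ (All.lookup witnesses p∈)
  where
  letters = unit 𝟎 ∷ unit 𝟏 ∷ unit 𝟐 ∷ []
  complete : ∀ i → parikhFactor x i 1 ∈ letters
  complete i = subst (_∈ letters) (sym (parikhFactor-suc x i 0))
    (from-yes (all? λ a → (unit a ⊕ (0 , 0 , 0)) ∈? letters) (x i))
  witnesses : All (λ p → ∃ λ i → i < 3 × parikhFactor x i 1 ≡ p) letters
  witnesses = from-yes (All.all? (λ p → anyUpTo? (λ i → parikhFactor x i 1 ≟ₚ p) 3) letters)

τ-𝟐 : ∀ r X → lookup (τ X) r ≡ 𝟐 → r ≡ 𝟐
τ-𝟐 = from-yes (all? λ r → all? λ X → (lookup (τ X) r ≟ 𝟐) →-dec (r ≟ 𝟐))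

x-𝟐 : ∀ r k → x (toℕ r + k * 3) ≡ 𝟐 → r ≡ 𝟐
x-𝟐 r k eq = τ-𝟐 r (β k) (trans (sym (x-digit r k)) eq)

x-no-𝟐𝟐 : ∀ i → ¬ (x i ≡ 𝟐 × x (suc i) ≡ 𝟐)
x-no-𝟐𝟐 i (first , second) with i divMod 3
... | result k r refl with x-𝟐 r k first
... | refl with x-𝟐 𝟎 (suc k) second
... | ()

abelianComplexity-2 : AbelianComplexity x 2 5
abelianComplexity-2 =
  pairs , from-yes (unique? pairs) , refl , complete , λ _ p∈ → map₂ proj₂ (All.lookup witnesses p∈)
  where
  pairs = (1 , 1 , 0) ∷ (0 , 1 , 1) ∷ (0 , 2 , 0) ∷ (1 , 0 , 1) ∷ (2 , 0 , 0) ∷ []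
  pair-∈ : ∀ a b → ¬ (a ≡ 𝟐 × b ≡ 𝟐) → unit a ⊕ (unit b ⊕ (0 , 0 , 0)) ∈ pairs
  pair-∈ = from-yes (all? λ a → all? λ b →
    ¬? ((a ≟ 𝟐) ×-dec (b ≟ 𝟐)) →-dec ((unit a ⊕ (unit b ⊕ (0 , 0 , 0))) ∈? pairs))
  complete : ∀ i → parikhFactor x i 2 ∈ pairs
  complete i = subst (_∈ pairs)
    (sym (trans (parikhFactor-suc x i 1) (cong (unit (x i) ⊕_) (parikhFactor-suc x (suc i) 0))))
    (pair-∈ (x i) (x (suc i)) (x-no-𝟐𝟐 i))
  witnesses : All (λ p → ∃ λ i → i < 7 × parikhFactor x i 2 ≡ p) pairs
  witnesses = from-yes (All.all? (λ p → anyUpTo? (λ i → parikhFactor x i 2 ≟ₚ p) 7) pairs)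

proposition19 : AbelianComplexity x 0 1 × AbelianComplexity x 1 3 × AbelianComplexity x 2 5
    × (∀ n → 3 ≤ n → (n % 3 ≡ 0 → AbelianComplexity x n 3) × (n % 3 ≢ 0 → AbelianComplexity x n 7))
proposition19 = abelianComplexity-0 , abelianComplexity-1 , abelianComplexity-2 , abelianComplexity-≥3
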